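{- Let $L$ be a Lie algebra of characteristic $0$ and $S$ a nilpotent subalgebra of nilpotency class $c$. Let $H$ be a subalgebra all of whose elements are ad-nilpotent in $L$, and let $N$ be the subalgebra generated by $\{f(S): f\in \operatorname{Int}(H)\}$. If $H\subseteq \bigcap_{i\le c}N_L(C_L^i(S))$, then $N$ is nilpotent.
   Context: $\operatorname{ad}_x(y)=[x,y]$; for ad-nilpotent $x$ ($\operatorname{ad}_x^n(L)=0$), $\exp(x)=\sum_{i=0}^{n-1}\operatorname{ad}_x^i/i!$, an automorphism of $L$. $\operatorname{Int}(H)$ is the subgroup of $\operatorname{Aut}(L)$ generated by $\exp(h)$, $h\in H$. $N_L(X)=\{x:[x,X]\subseteq X\}$. Iterated centralizers: $C_L^0(S)=\{0\}$, $C_L^{n+1}(S)=\{x\in\bigcap_{1\le i\le n}N_L(C_L^i(S)):[x,S]\subseteq C_L^n(S)\}$. -}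

module Defs where

open import Level using (Level; _⊔_) renaming (suc to lsuc)
open import Algebra.Bundles using (CommutativeRing)
open import Algebra.Module.Bundles using (Module)
open import Data.Nat using (ℕ; zero; suc; _<_)
open import Data.Product using (Σ; _×_; _,_; proj₁; proj₂; ∃)
open import Data.List using (List; []; _∷_)
open import Data.Unit.Polymorphic using (⊤)
open import Relation.Nullary using (¬_)

record Field c ℓ : Set (lsuc (c ⊔ ℓ)) where
  field
    commutativeRing : CommutativeRing c ℓ
  open CommutativeRing commutativeRing public
  field
    0≉1     : ¬ (0# ≈ 1#)
    inv     : (x : Carrier) → ¬ (x ≈ 0#) → Carrier
    inverse : (x : Carrier) (p : ¬ (x ≈ 0#)) → (x * inv x p) ≈ 1#

  nat : ℕ → Carrier
  nat zero    = 0#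
  nat (suc n) = 1# + nat n

  CharZero : Set ℓ
  CharZero = (n : ℕ) → ¬ (nat (suc n) ≈ 0#)

  invFact : CharZero → ℕ → Carrier
  invFact ch zero    = 1#
  invFact ch (suc i) = inv (nat (suc i)) (ch i) * invFact ch i

record LieAlgebra {c ℓ} (F : Field c ℓ) m ℓm : Set (c ⊔ ℓ ⊔ lsuc (m ⊔ ℓm)) where
  open Field F using (commutativeRing; Carrier)
  field
    module′ : Module commutativeRing m ℓm
  open Module module′ public
  field
    [_,_]    : Carrierᴹ → Carrierᴹ → Carrierᴹ
    [,]-cong : ∀ {x x′ y y′} → x ≈ᴹ x′ → y ≈ᴹ y′ → [ x , y ] ≈ᴹ [ x′ , y′ ]
    [,]-+ˡ   : ∀ x y z → [ x +ᴹ y , z ] ≈ᴹ [ x , z ] +ᴹ [ y , z ]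
    [,]-+ʳ   : ∀ x y z → [ x , y +ᴹ z ] ≈ᴹ [ x , y ] +ᴹ [ x , z ]
    [,]-*ˡ   : ∀ (a : Carrier) x y → [ a *ₗ x , y ] ≈ᴹ a *ₗ [ x , y ]
    [,]-*ʳ   : ∀ (a : Carrier) x y → [ x , a *ₗ y ] ≈ᴹ a *ₗ [ x , y ]
    [,]-alt  : ∀ x → [ x , x ] ≈ᴹ 0ᴹ
    jacobi   : ∀ x y z →
               ([ x , [ y , z ] ] +ᴹ [ y , [ z , x ] ]) +ᴹ [ z , [ x , y ] ] ≈ᴹ 0ᴹ

module Lie {c ℓ m ℓm} {F : Field c ℓ} (L : LieAlgebra F m ℓm) where
  open Field F using (Carrier; CharZero; invFact)
  open LieAlgebra L

  Subset : (p : Level) → Set (m ⊔ lsuc p)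
  Subset p = Carrierᴹ → Set p

  record IsSubalgebra {p} (X : Subset p) : Set (c ⊔ m ⊔ ℓm ⊔ p) where
    field
      resp : ∀ {x y} → x ≈ᴹ y → X x → X y
      0∈   : X 0ᴹ
      +∈   : ∀ {x y} → X x → X y → X (x +ᴹ y)
      *∈   : ∀ (a : Carrier) {x} → X x → X (a *ₗ x)
      [,]∈ : ∀ {x y} → X x → X y → X [ x , y ]

  ad : Carrierᴹ → Carrierᴹ → Carrierᴹ
  ad x y = [ x , y ]

  adPow : ℕ → Carrierᴹ → Carrierᴹ → Carrierᴹ
  adPow zero    x y = y
  adPow (suc n) x y = ad x (adPow n x y)

  AdNilpotent : Carrierᴹ → Set (m ⊔ ℓm)
  AdNilpotent x = ∃ λ (n : ℕ) → ∀ y → adPow n x y ≈ᴹ 0ᴹ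

  expWith : CharZero → Carrierᴹ → ℕ → Carrierᴹ → Carrierᴹ
  expWith ch x zero    y = 0ᴹ
  expWith ch x (suc n) y = expWith ch x n y +ᴹ (invFact ch n *ₗ adPow n x y)

  exp : CharZero → (x : Carrierᴹ) → AdNilpotent x → Carrierᴹ → Carrierᴹ
  exp ch x nil = expWith ch x (proj₁ nil)

  -- Int(H): the automorphisms exp(h₁) ∘ ⋯ ∘ exp(hₖ), hᵢ ∈ H, represented
  -- by the word (h₁,…,hₖ).  (exp(h)⁻¹ = exp(-h) with -h ∈ H, so these
  -- form the subgroup generated by the exp(h).)
  IntWord : ∀ {p} → Subset p → Set (m ⊔ p)
  IntWord H = List (Σ Carrierᴹ H)

  evalInt : ∀ {p} → CharZero → (H : Subset p) → (∀ h → H h → AdNilpotent h) →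
            IntWord H → Carrierᴹ → Carrierᴹ
  evalInt ch H nil []             y = y
  evalInt ch H nil ((h , hH) ∷ w) y = exp ch h (nil h hH) (evalInt ch H nil w y)

  IntImage : ∀ {p q} → CharZero → (H : Subset p) → (∀ h → H h → AdNilpotent h) →
             Subset q → Subset (m ⊔ ℓm ⊔ p ⊔ q)
  IntImage ch H nil S x =
    ∃ λ (w : IntWord H) → ∃ λ s → S s × (x ≈ᴹ evalInt ch H nil w s)

  data Gen {p} (G : Subset p) : Subset (c ⊔ m ⊔ ℓm ⊔ p) where
    gen  : ∀ {x} → G x → Gen G x
    resp : ∀ {x y} → x ≈ᴹ y → Gen G x → Gen G y
    0∈   : Gen G 0ᴹ
    +∈   : ∀ {x y} → Gen G x → Gen G y → Gen G (x +ᴹ y)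
    *∈   : ∀ (a : Carrier) {x} → Gen G x → Gen G (a *ₗ x)
    [,]∈ : ∀ {x y} → Gen G x → Gen G y → Gen G [ x , y ]

  -- lower central series: Γ X k = γ_{k+1}(X), with γ_1(X) = X and
  -- γ_{k+2}(X) = span{[x,y] : x ∈ X, y ∈ γ_{k+1}(X)}
  data Γ {p} (X : Subset p) : ℕ → Subset (c ⊔ m ⊔ ℓm ⊔ p) where
    base : ∀ {x} → X x → Γ X zero x
    brk  : ∀ {k x y} → X x → Γ X k y → Γ X (suc k) [ x , y ]
    resp : ∀ {k x y} → x ≈ᴹ y → Γ X (suc k) x → Γ X (suc k) y
    0∈   : ∀ {k} → Γ X (suc k) 0ᴹ
    +∈   : ∀ {k x y} → Γ X (suc k) x → Γ X (suc k) y → Γ X (suc k) (x +ᴹ y)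
    *∈   : ∀ {k} (a : Carrier) {x} → Γ X (suc k) x → Γ X (suc k) (a *ₗ x)

  IsZero : ∀ {p} → Subset p → Set (m ⊔ ℓm ⊔ p)
  IsZero X = ∀ x → X x → x ≈ᴹ 0ᴹ

  Nilpotent : ∀ {p} → Subset p → Set (c ⊔ m ⊔ ℓm ⊔ p)
  Nilpotent X = ∃ λ (k : ℕ) → IsZero (Γ X k)

  NilpotencyClass : ∀ {p} → Subset p → ℕ → Set (c ⊔ m ⊔ ℓm ⊔ p)
  NilpotencyClass X cl = IsZero (Γ X cl) × (∀ d → d < cl → ¬ IsZero (Γ X d))

  Normalizer : ∀ {p} → Subset p → Subset (m ⊔ p)
  Normalizer X x = ∀ y → X y → X [ x , y ]

  -- iterated centralizers C^n_L(S), together with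
  -- NormAll S n x  ⇔  x ∈ ⋂_{1≤i≤n} N_L(C^i_L(S))
  mutual
    C : ∀ {p} → Subset p → ℕ → Subset (m ⊔ ℓm ⊔ p)
    C {p} S zero    x = Level.Lift (m ⊔ p) (x ≈ᴹ 0ᴹ)
    C S (suc n) x = NormAll S n x × (∀ s → S s → C S n [ x , s ])

    NormAll : ∀ {p} → Subset p → ℕ → Subset (m ⊔ ℓm ⊔ p)
    NormAll S zero    x = ⊤
    NormAll S (suc n) x = NormAll S n x × Normalizer (C S (suc n)) x

{-# OPTIONS --safe #-}
module Submission where

-- Let Compatible be the set of x that normalize every C^i(S) with i ≤ cl, map
-- C^{i+1}(S) into C^i(S) for i < cl, and lie in C^cl(S).  By the Leibniz form of
-- the Jacobi identity it is a subalgebra, and ad_x preserves it as soon as x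
-- normalizes the C^i(S); it contains S because γ_{cl+1}(S) = 0 forces
-- γ_{cl+1-j}(S) ⊆ C^j(S).  The hypothesis makes it stable under ad_h, h ∈ H,
-- hence under every exp(h), so it contains N.  Finally γ_{k+1}(N) ⊆ C^{cl-k}(S)
-- by induction on k, and C^0(S) = 0.

open import Defs
open import Level using (Level; _⊔_; lift; lower)
open import Function using (id)
open import Data.Nat using (ℕ; zero; suc; _+_; _∸_; _≤_; _<_; pred)
open import Data.Nat.Properties
  using (≤-refl; <⇒≤; +-suc; +-identityʳ; m∸n≤m; pred[m∸n]≡m∸[1+n]; n∸n≡0)
open import Data.Product using (_,_; proj₁; proj₂)
open import Data.List using ([]; _∷_)
open import Data.Unit.Polymorphic using (tt)
open import Relation.Unary using (_⊆_; _∩_)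
import Relation.Binary.PropositionalEquality as ≡
import Algebra.Module.Properties as ModuleProperties
import Relation.Binary.Reasoning.Setoid as SetoidReasoning

module LieAlgebraTheory {c ℓ m ℓm} {F : Field c ℓ} (L : LieAlgebra F m ℓm) where
  open Field F using (Carrier; CharZero; 0#; 1#; -_; -‿inverseʳ) renaming (_+_ to _+ᶠ_)
  open LieAlgebra L
  open Lie L hiding (resp; 0∈; +∈; *∈; [,]∈)
  open ModuleProperties module′ using (inverseʳ-uniqueᴹ; -ᴹ-involutive)
  open SetoidReasoning ≈ᴹ-setoid

  -1*ₗ≈-ᴹ : ∀ x → (- 1#) *ₗ x ≈ᴹ -ᴹ x
  -1*ₗ≈-ᴹ x = inverseʳ-uniqueᴹ x _ (begin
    x +ᴹ (- 1#) *ₗ x        ≈⟨ +ᴹ-congʳ (≈ᴹ-sym (*ₗ-identityˡ x)) ⟩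
    1# *ₗ x +ᴹ (- 1#) *ₗ x  ≈⟨ ≈ᴹ-sym (*ₗ-distribʳ x 1# (- 1#)) ⟩
    (1# +ᶠ - 1#) *ₗ x       ≈⟨ *ₗ-congʳ (-‿inverseʳ 1#) ⟩
    0# *ₗ x                 ≈⟨ *ₗ-zeroˡ x ⟩
    0ᴹ                      ∎)

  [,]-zeroˡ : ∀ x → [ 0ᴹ , x ] ≈ᴹ 0ᴹ
  [,]-zeroˡ x = begin
    [ 0ᴹ , x ]        ≈⟨ [,]-cong (≈ᴹ-sym (*ₗ-zeroˡ 0ᴹ)) ≈ᴹ-refl ⟩
    [ 0# *ₗ 0ᴹ , x ]  ≈⟨ [,]-*ˡ 0# 0ᴹ x ⟩
    0# *ₗ [ 0ᴹ , x ]  ≈⟨ *ₗ-zeroˡ _ ⟩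
    0ᴹ                ∎

  [,]-zeroʳ : ∀ x → [ x , 0ᴹ ] ≈ᴹ 0ᴹ
  [,]-zeroʳ x = begin
    [ x , 0ᴹ ]        ≈⟨ [,]-cong ≈ᴹ-refl (≈ᴹ-sym (*ₗ-zeroˡ 0ᴹ)) ⟩
    [ x , 0# *ₗ 0ᴹ ]  ≈⟨ [,]-*ʳ 0# x 0ᴹ ⟩
    0# *ₗ [ x , 0ᴹ ]  ≈⟨ *ₗ-zeroˡ _ ⟩
    0ᴹ                ∎

  [,]-anticomm : ∀ x y → [ y , x ] ≈ᴹ -ᴹ [ x , y ]
  [,]-anticomm x y = inverseʳ-uniqueᴹ _ _ (begin
    [ x , y ] +ᴹ [ y , x ]
      ≈⟨ ≈ᴹ-sym (+ᴹ-cong (+ᴹ-identityˡ _) (+ᴹ-identityʳ _)) ⟩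
    (0ᴹ +ᴹ [ x , y ]) +ᴹ ([ y , x ] +ᴹ 0ᴹ)
      ≈⟨ ≈ᴹ-sym (+ᴹ-cong (+ᴹ-congʳ ([,]-alt x)) (+ᴹ-congˡ ([,]-alt y))) ⟩
    ([ x , x ] +ᴹ [ x , y ]) +ᴹ ([ y , x ] +ᴹ [ y , y ])
      ≈⟨ ≈ᴹ-sym (+ᴹ-cong ([,]-+ʳ x x y) ([,]-+ʳ y x y)) ⟩
    [ x , x +ᴹ y ] +ᴹ [ y , x +ᴹ y ]
      ≈⟨ ≈ᴹ-sym ([,]-+ˡ x y _) ⟩
    [ x +ᴹ y , x +ᴹ y ]
      ≈⟨ [,]-alt _ ⟩
    0ᴹ ∎)

  [,]-negʳ : ∀ x y → [ x , -ᴹ y ] ≈ᴹ -ᴹ [ x , y ]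
  [,]-negʳ x y = begin
    [ x , -ᴹ y ]         ≈⟨ [,]-cong ≈ᴹ-refl (≈ᴹ-sym (-1*ₗ≈-ᴹ y)) ⟩
    [ x , (- 1#) *ₗ y ]  ≈⟨ [,]-*ʳ (- 1#) x y ⟩
    (- 1#) *ₗ [ x , y ]  ≈⟨ -1*ₗ≈-ᴹ _ ⟩
    -ᴹ [ x , y ]         ∎

  [,]-leibniz : ∀ x y z → [ [ x , y ] , z ] ≈ᴹ [ x , [ y , z ] ] +ᴹ -ᴹ [ y , [ x , z ] ]
  [,]-leibniz x y z = begin
    [ [ x , y ] , z ]
      ≈⟨ [,]-anticomm z _ ⟩
    -ᴹ [ z , [ x , y ] ]
      ≈⟨ -ᴹ‿cong (inverseʳ-uniqueᴹ _ _ (jacobi x y z)) ⟩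
    -ᴹ -ᴹ ([ x , [ y , z ] ] +ᴹ [ y , [ z , x ] ])
      ≈⟨ -ᴹ-involutive _ ⟩
    [ x , [ y , z ] ] +ᴹ [ y , [ z , x ] ]
      ≈⟨ +ᴹ-congˡ ([,]-cong ≈ᴹ-refl ([,]-anticomm x z)) ⟩
    [ x , [ y , z ] ] +ᴹ [ y , -ᴹ [ x , z ] ]
      ≈⟨ +ᴹ-congˡ ([,]-negʳ y _) ⟩
    [ x , [ y , z ] ] +ᴹ -ᴹ [ y , [ x , z ] ] ∎

  record IsSubspace {p} (X : Subset p) : Set (c ⊔ m ⊔ ℓm ⊔ p) where
    field
      resp : ∀ {x y} → x ≈ᴹ y → X x → X y
      0∈   : X 0ᴹ
      +∈   : ∀ {x y} → X x → X y → X (x +ᴹ y)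
      *∈   : ∀ (a : Carrier) {x} → X x → X (a *ₗ x)

    -∈ : ∀ {x} → X x → X (-ᴹ x)
    -∈ x∈ = resp (-1*ₗ≈-ᴹ _) (*∈ (- 1#) x∈)

    anticomm-∈ : ∀ {x y} → X [ x , y ] → X [ y , x ]
    anticomm-∈ x∈ = resp (≈ᴹ-sym ([,]-anticomm _ _)) (-∈ x∈)

    leibniz-∈ : ∀ {x y z} → X [ x , [ y , z ] ] → X [ y , [ x , z ] ] → X [ [ x , y ] , z ]
    leibniz-∈ x∈ y∈ = resp (≈ᴹ-sym ([,]-leibniz _ _ _)) (+∈ x∈ (-∈ y∈))

  IsSubalgebra⇒IsSubspace : ∀ {p} {X : Subset p} → IsSubalgebra X → IsSubspace X
  IsSubalgebra⇒IsSubspace X-sub = record { IsSubalgebra X-sub }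

  ∩-isSubspace : ∀ {p q} {X : Subset p} {Y : Subset q} →
                 IsSubspace X → IsSubspace Y → IsSubspace (X ∩ Y)
  ∩-isSubspace X-sub Y-sub = record
    { resp = λ e (x∈ , y∈) → X.resp e x∈ , Y.resp e y∈
    ; 0∈   = X.0∈ , Y.0∈
    ; +∈   = λ (x∈ , y∈) (x∈′ , y∈′) → X.+∈ x∈ x∈′ , Y.+∈ y∈ y∈′
    ; *∈   = λ a (x∈ , y∈) → X.*∈ a x∈ , Y.*∈ a y∈
    }
    where
    module X = IsSubspace X-sub
    module Y = IsSubspace Y-sub

  Π-isSubspace : ∀ {p} {I : Set} {X : I → Subset p} →
                 (∀ i → IsSubspace (X i)) → IsSubspace (λ y → ∀ i → X i y)
  Π-isSubspace X-sub = record
    { resp = λ e y∈ i → IsSubspace.resp (X-sub i) e (y∈ i)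
    ; 0∈   = λ i → IsSubspace.0∈ (X-sub i)
    ; +∈   = λ y∈ y∈′ i → IsSubspace.+∈ (X-sub i) (y∈ i) (y∈′ i)
    ; *∈   = λ a y∈ i → IsSubspace.*∈ (X-sub i) a (y∈ i)
    }

  Transporter : ∀ {p q} → Subset p → Subset q → Subset (m ⊔ p ⊔ q)
  Transporter A B x = ∀ y → A y → B [ x , y ]

  Transporter-isSubspace : ∀ {p q} {A : Subset p} {B : Subset q} →
                           IsSubspace B → IsSubspace (Transporter A B)
  Transporter-isSubspace B-sub = record
    { resp = λ e x∈ y y∈ → B.resp ([,]-cong e ≈ᴹ-refl) (x∈ y y∈)
    ; 0∈   = λ y _ → B.resp (≈ᴹ-sym ([,]-zeroˡ y)) B.0∈
    ; +∈   = λ x∈ x∈′ y y∈ → B.resp (≈ᴹ-sym ([,]-+ˡ _ _ y)) (B.+∈ (x∈ y y∈) (x∈′ y y∈))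
    ; *∈   = λ a x∈ y y∈ → B.resp (≈ᴹ-sym ([,]-*ˡ a _ y)) (B.*∈ a (x∈ y y∈))
    }
    where module B = IsSubspace B-sub

  [,]-transporter : ∀ {p q} {A : Subset p} {B : Subset q} {x y} → IsSubspace B →
                    Normalizer A x → Normalizer B x → Transporter A B y →
                    Transporter A B [ x , y ]
  [,]-transporter B-sub x-A x-B y-AB z z∈ =
    IsSubspace.leibniz-∈ B-sub (x-B _ (y-AB z z∈)) (y-AB _ (x-A z z∈))

  Gen-⊆ : ∀ {p q} {G : Subset p} {X : Subset q} → IsSubalgebra X → G ⊆ X → Gen G ⊆ X
  Gen-⊆ {G = G} {X} X-sub G⊆X = go
    where
    open IsSubalgebra X-sub
    go : Gen G ⊆ X
    go (gen g∈)          = G⊆X g∈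
    go (Gen.resp e x∈)   = resp e (go x∈)
    go Gen.0∈            = 0∈
    go (Gen.+∈ x∈ y∈)    = +∈ (go x∈) (go y∈)
    go (Gen.*∈ a x∈)     = *∈ a (go x∈)
    go (Gen.[,]∈ x∈ y∈)  = [,]∈ (go x∈) (go y∈)

  Γ-minimal : ∀ {p q} {X : Subset p} (Y : ℕ → Subset q) → (∀ k → IsSubspace (Y k)) →
              X ⊆ Y 0 → (∀ {k x y} → X x → Y k y → Y (suc k) [ x , y ]) →
              ∀ {k} → Γ X k ⊆ Y k
  Γ-minimal {X = X} Y Y-sub X⊆Y₀ step = go
    where
    go : ∀ {k} → Γ X k ⊆ Y k
    go (base x∈)          = X⊆Y₀ x∈
    go (brk x∈ y∈)        = step x∈ (go y∈)
    go {k} (Γ.resp e y∈)  = IsSubspace.resp (Y-sub k) e (go y∈)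
    go {k} Γ.0∈           = IsSubspace.0∈ (Y-sub k)
    go {k} (Γ.+∈ x∈ y∈)   = IsSubspace.+∈ (Y-sub k) (go x∈) (go y∈)
    go {k} (Γ.*∈ a y∈)    = IsSubspace.*∈ (Y-sub k) a (go y∈)

  Γ-⊆ : ∀ {p} {X : Subset p} → IsSubalgebra X → ∀ {k} → Γ X k ⊆ X
  Γ-⊆ {X = X} X-sub =
    Γ-minimal (λ _ → X) (λ _ → IsSubalgebra⇒IsSubspace X-sub) id (IsSubalgebra.[,]∈ X-sub)

  adPow-∈ : ∀ {p} {X : Subset p} {h y} → Normalizer X h → ∀ n → X y → X (adPow n h y)
  adPow-∈ h-X zero    y∈ = y∈
  adPow-∈ h-X (suc n) y∈ = h-X _ (adPow-∈ h-X n y∈)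

  module _ (ch : CharZero) {p} {X : Subset p} (X-sub : IsSubspace X) where
    open IsSubspace X-sub

    expWith-∈ : ∀ {h y} → Normalizer X h → ∀ n → X y → X (expWith ch h n y)
    expWith-∈ h-X zero    y∈ = 0∈
    expWith-∈ h-X (suc n) y∈ = +∈ (expWith-∈ h-X n y∈) (*∈ _ (adPow-∈ h-X n y∈))

    IntImage-⊆ : ∀ {q r} {H : Subset q} (adNil : ∀ h → H h → AdNilpotent h) {S : Subset r} →
                 H ⊆ Normalizer X → S ⊆ X → IntImage ch H adNil S ⊆ X
    IntImage-⊆ {H = H} adNil H⊆ S⊆X (w , s , s∈ , e) =
      resp (≈ᴹ-sym e) (evalInt-∈ w (S⊆X s∈))
      where
      evalInt-∈ : ∀ w {y} → X y → X (evalInt ch H adNil w y)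
      evalInt-∈ []             y∈ = y∈
      evalInt-∈ ((h , h∈) ∷ w) y∈ = expWith-∈ (H⊆ h∈) (proj₁ (adNil h h∈)) (evalInt-∈ w y∈)

  module Centralizers {p} (S : Subset p) where

    mutual
      C-isSubspace : ∀ n → IsSubspace (C S n)
      C-isSubspace zero = record
        { resp = λ e (lift x≈0) → lift (≈ᴹ-trans (≈ᴹ-sym e) x≈0)
        ; 0∈   = lift ≈ᴹ-refl
        ; +∈   = λ (lift x≈0) (lift y≈0) → lift (≈ᴹ-trans (+ᴹ-cong x≈0 y≈0) (+ᴹ-identityˡ 0ᴹ))
        ; *∈   = λ a (lift x≈0) → lift (≈ᴹ-trans (*ₗ-congˡ x≈0) (*ₗ-zeroʳ a))
        }
      C-isSubspace (suc n) =
        ∩-isSubspace (NormAll-isSubspace n) (Transporter-isSubspace (C-isSubspace n))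

      NormAll-isSubspace : ∀ n → IsSubspace (NormAll S n)
      NormAll-isSubspace zero = record
        { resp = λ _ _ → tt ; 0∈ = tt ; +∈ = λ _ _ → tt ; *∈ = λ _ _ → tt }
      NormAll-isSubspace (suc n) =
        ∩-isSubspace (NormAll-isSubspace n) (Transporter-isSubspace (C-isSubspace (suc n)))

    Normalizer-C₀ : ∀ x → Normalizer (C S 0) x
    Normalizer-C₀ x y (lift y≈0) = lift (≈ᴹ-trans ([,]-cong ≈ᴹ-refl y≈0) ([,]-zeroʳ x))

    NormAll⇒Normalizer : ∀ n → NormAll S n ⊆ Normalizer (C S n)
    NormAll⇒Normalizer zero    _ = Normalizer-C₀ _
    NormAll⇒Normalizer (suc n) (_ , x-Cₙ₊₁) = x-Cₙ₊₁

    NormAll-[,] : ∀ n {x y} → NormAll S n x → NormAll S n y → NormAll S n [ x , y ]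
    NormAll-[,] zero    _ _ = tt
    NormAll-[,] (suc n) (x∈ , x-Cₙ₊₁) (y∈ , y-Cₙ₊₁) =
      NormAll-[,] n x∈ y∈ , [,]-transporter (C-isSubspace (suc n)) x-Cₙ₊₁ x-Cₙ₊₁ y-Cₙ₊₁

    module _ (S-sub : IsSubalgebra S) where

      S⊆NormAll : ∀ n → S ⊆ NormAll S n
      S⊆NormAll zero    _  = tt
      S⊆NormAll (suc n) s∈ = S⊆NormAll n s∈ , λ z (z∈ , z-SCₙ) →
        NormAll-[,] n (S⊆NormAll n s∈) z∈ ,
        [,]-transporter (C-isSubspace n) (λ _ → IsSubalgebra.[,]∈ S-sub s∈)
                        (NormAll⇒Normalizer n (S⊆NormAll n s∈)) z-SCₙ

      Γ⊆C : ∀ j {k} → IsZero (Γ S (j + k)) → Γ S k ⊆ C S j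
      Γ⊆C zero        Γ≈0 y∈ = lift (Γ≈0 _ y∈)
      Γ⊆C (suc j) {k} Γ≈0 y∈ = S⊆NormAll j (Γ-⊆ S-sub y∈) , λ t t∈ →
        IsSubspace.anticomm-∈ (C-isSubspace j) (Γ⊆C j Γ′≈0 (brk t∈ y∈))
        where
        Γ′≈0 : IsZero (Γ S (j + suc k))
        Γ′≈0 = ≡.subst (λ n → IsZero (Γ S n)) (≡.sym (+-suc j k)) Γ≈0

      S⊆C : ∀ {cl} → IsZero (Γ S cl) → S ⊆ C S cl
      S⊆C {cl} Γ≈0 s∈ = Γ⊆C cl Γ′≈0 (base s∈)
        where
        Γ′≈0 : IsZero (Γ S (cl + 0))
        Γ′≈0 = ≡.subst (λ n → IsZero (Γ S n)) (≡.sym (+-identityʳ cl)) Γ≈0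

    module _ (cl : ℕ) where

      NormalizesUpTo : Subset (m ⊔ ℓm ⊔ p)
      NormalizesUpTo x = ∀ i → i ≤ cl → Normalizer (C S i) x

      LowersUpTo : Subset (m ⊔ ℓm ⊔ p)
      LowersUpTo x = ∀ i → i < cl → Transporter (C S (suc i)) (C S i) x

      Compatible : Subset (m ⊔ ℓm ⊔ p)
      Compatible = NormalizesUpTo ∩ LowersUpTo ∩ C S cl

      Compatible-isSubspace : IsSubspace Compatible
      Compatible-isSubspace =
        ∩-isSubspace transportersInto-C (∩-isSubspace transportersInto-C (C-isSubspace cl))
        where
        transportersInto-C : ∀ {q} {A : ℕ → Subset q} {P : ℕ → Set} →
                             IsSubspace (λ x → ∀ i → P i → Transporter (A i) (C S i) x)
        transportersInto-C = Π-isSubspace λ i → Π-isSubspace λ _ → Transporter-isSubspace (C-isSubspace i)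

      NormalizesUpTo⇒Normalizer : ∀ {x} → NormalizesUpTo x → Normalizer Compatible x
      NormalizesUpTo⇒Normalizer x-N y (y-N , y-L , y∈) =
        (λ i i≤cl → [,]-transporter (C-isSubspace i) (x-N i i≤cl) (x-N i i≤cl) (y-N i i≤cl)) ,
        (λ i i<cl → [,]-transporter (C-isSubspace i) (x-N (suc i) i<cl) (x-N i (<⇒≤ i<cl)) (y-L i i<cl)) ,
        x-N cl ≤-refl y y∈

      Compatible-isSubalgebra : IsSubalgebra Compatible
      Compatible-isSubalgebra = record
        { resp = resp ; 0∈ = 0∈ ; +∈ = +∈ ; *∈ = *∈
        ; [,]∈ = λ x∈ y∈ → NormalizesUpTo⇒Normalizer (proj₁ x∈) _ y∈
        }
        where open IsSubspace Compatible-isSubspace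

      S⊆Compatible : IsSubalgebra S → IsZero (Γ S cl) → S ⊆ Compatible
      S⊆Compatible S-sub Γ≈0 s∈ =
        (λ i _ → NormAll⇒Normalizer i (S⊆NormAll S-sub i s∈)) ,
        (λ i _ z (_ , z-SCᵢ) → IsSubspace.anticomm-∈ (C-isSubspace i) (z-SCᵢ _ s∈)) ,
        S⊆C S-sub Γ≈0 s∈

      LowersUpTo⇒pred : ∀ {x} → LowersUpTo x → ∀ n → n ≤ cl →
                        Transporter (C S n) (C S (pred n)) x
      LowersUpTo⇒pred _   zero    _    = Normalizer-C₀ _
      LowersUpTo⇒pred x-L (suc n) n<cl = x-L n n<cl

      Γ⊆C-∸ : ∀ {q} {X : Subset q} → X ⊆ Compatible → ∀ {k} → Γ X k ⊆ C S (cl ∸ k)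
      Γ⊆C-∸ {X = X} X⊆ = Γ-minimal (λ k → C S (cl ∸ k)) (λ k → C-isSubspace (cl ∸ k))
                                   (λ x∈ → proj₂ (proj₂ (X⊆ x∈))) step
        where
        step : ∀ {k x y} → X x → C S (cl ∸ k) y → C S (cl ∸ suc k) [ x , y ]
        step {k} {x} {y} x∈ y∈ = ≡.subst (λ n → C S n [ x , y ]) (pred[m∸n]≡m∸[1+n] cl k)
          (LowersUpTo⇒pred (proj₁ (proj₂ (X⊆ x∈))) (cl ∸ k) (m∸n≤m cl k) _ y∈)

      ⊆Compatible⇒Γ≈0 : ∀ {q} {X : Subset q} → X ⊆ Compatible → IsZero (Γ X cl)
      ⊆Compatible⇒Γ≈0 X⊆ y y∈ = lower (≡.subst (λ n → C S n y) (n∸n≡0 cl) (Γ⊆C-∸ X⊆ y∈))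

mainTheorem16 : ∀ {c ℓ m ℓm p q : Level} (F : Field c ℓ) (L : LieAlgebra F m ℓm) →
    (ch : Field.CharZero F) →
    (S : Lie.Subset L p) → Lie.IsSubalgebra L S →
    (cl : ℕ) → Lie.NilpotencyClass L S cl →
    (H : Lie.Subset L q) → Lie.IsSubalgebra L H →
    (adNil : ∀ h → H h → Lie.AdNilpotent L h) →
    (∀ i → i ≤ cl → ∀ h → H h → Lie.Normalizer L (Lie.C L S i) h) →
    Lie.Nilpotent L (Lie.Gen L (Lie.IntImage L ch H adNil S))
mainTheorem16 F L ch S S-sub cl (Γ≈0 , _) H _ adNil H-normalizes =
  cl , ⊆Compatible⇒Γ≈0 cl N⊆Compatible
  where
  open LieAlgebraTheory L
  open Centralizers S
  open Lie L using (Gen; IntImage)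

  H⊆Normalizer : H ⊆ Lie.Normalizer L (Compatible cl)
  H⊆Normalizer h∈ = NormalizesUpTo⇒Normalizer cl (λ i i≤cl → H-normalizes i i≤cl _ h∈)

  N⊆Compatible : Gen (IntImage ch H adNil S) ⊆ Compatible cl
  N⊆Compatible = Gen-⊆ (Compatible-isSubalgebra cl)
    (IntImage-⊆ ch (Compatible-isSubspace cl) adNil H⊆Normalizer (S⊆Compatible cl S-sub Γ≈0))
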